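{- Fix an integer $n \geq 2$ and a prime $p$, and let $m$ be the minimum integer such that $p^m \geq n$. Let $G$ be a finite $p$-group, and let $G^\#$ denote the intersection of the kernels of all group morphisms from $G$ to finite groups all of whose elements have order dividing $p^m$. Suppose that every element of $G/G^\#$ has a representative in $G$ of order dividing $p^m$. Then $G^\# = \{1\}$. -}

module Defs where

open import Level using (Level; _⊔_; suc)
open import Data.Nat using (ℕ; _^_)
open import Data.Fin using (Fin)
open import Data.Product using (∃; Σ; _×_)
open import Function.Bundles using (Inverse)
open import Relation.Binary.PropositionalEquality using (setoid)
open import Algebra.Bundles using (Group)
open import Algebra.Morphism.Structures using (module GroupMorphisms)
import Algebra.Definitions.RawMonoid as RM

pow : ∀ {c ℓ} (G : Group c ℓ) → Group.Carrier G → ℕ → Group.Carrier G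
pow G x k = RM._×_ (Group.rawMonoid G) k x

OrderDivides : ∀ {c ℓ} (G : Group c ℓ) → Group.Carrier G → ℕ → Set ℓ
OrderDivides G x N = Group._≈_ G (pow G x N) (Group.ε G)

HasOrder : ∀ {c ℓ} (G : Group c ℓ) → ℕ → Set (c ⊔ ℓ)
HasOrder G k = Inverse (Group.setoid G) (setoid (Fin k))

IsFiniteGroup : ∀ {c ℓ} (G : Group c ℓ) → Set (c ⊔ ℓ)
IsFiniteGroup G = ∃ λ k → HasOrder G k

IsFinitePGroup : ∀ {c ℓ} (p : ℕ) (G : Group c ℓ) → Set (c ⊔ ℓ)
IsFinitePGroup p G = ∃ λ k → HasOrder G (p ^ k)

ExponentDivides : ∀ {c ℓ} (H : Group c ℓ) → ℕ → Set (c ⊔ ℓ)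
ExponentDivides H N = ∀ x → OrderDivides H x N

IsGroupHom : ∀ {c ℓ c' ℓ'} (G : Group c ℓ) (H : Group c' ℓ') →
             (Group.Carrier G → Group.Carrier H) → Set (c ⊔ ℓ ⊔ ℓ')
IsGroupHom G H f = GroupMorphisms.IsGroupHomomorphism (Group.rawGroup G) (Group.rawGroup H) f

-- G^# (for exponent N): x ∈ G^# iff f x = 1 for every homomorphism f from G
-- to a finite group H (with carrier/equality at the same universe levels as G)
-- all of whose elements have order dividing N.
InSharp : ∀ {c ℓ} (G : Group c ℓ) → ℕ → Group.Carrier G → Set (suc (c ⊔ ℓ))
InSharp {c} {ℓ} G N x =
  (H : Group c ℓ) → IsFiniteGroup H → ExponentDivides H N →
  (f : Group.Carrier G → Group.Carrier H) → IsGroupHom G H f →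
  Group._≈_ H (f x) (Group.ε H)

-- Induction on |G| = p ^ k, showing that G itself has exponent dividing q = p ^ m (all that
-- matters is p ∣ q); then G^# is trivial, the identity G → G being one of the morphisms that
-- define it. By the class equation a nontrivial p-group has a central element z of order p.
-- Morphisms out of G/⟨z⟩ are morphisms out of G, so G^# maps into (G/⟨z⟩)^# and G/⟨z⟩
-- inherits the hypothesis; by induction (G/⟨z⟩)^# is trivial. Hence every g ∈ G is g = h c
-- with h ^ q = 1 and c ∈ ⟨z⟩ central, and g ^ q = h ^ q c ^ q = 1.

{-# OPTIONS --safe #-}
module Submission where

open import Level using (Level; _⊔_) renaming (suc to lsuc)
open import Data.Nat
  using ( ℕ; zero; suc; _+_; _*_; _∸_; _^_; _≤_; _<_; _<?_; z≤n; s≤s; NonZero; pred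
        ; >-nonZero; >-nonZero⁻¹ )
open import Data.Nat.Properties
  using ( +-*-semiring; +-comm; *-comm; *-identityʳ; *-zeroʳ; <-irrefl; <-cmp; ≤-<-trans; <⇒≤; <⇒≱
        ; n<1+n; +-mono-≤; +-mono-≤-<; *-monoˡ-<; *-cancelʳ-≡; m∸n≤m; m+[n∸m]≡n; m<n⇒0<n∸m; suc-pred
        ; m*n≢0; m*n≢0⇒m≢0; m*n≢0⇒n≢0 )
open import Data.Nat.DivMod using (_%_; _/_; m≡m%n+[m/n]*n; m%n<n)
open import Data.Nat.Divisibility
  using (_∣_; divides; _∣?_; _∣0; ∣1⇒≡1; m∣m*n; ∣m∣n⇒∣m+n; ∣m+n∣m⇒∣n)
open import Data.Nat.Primality using (Prime; prime⇒irreducible; prime⇒nonZero; ¬prime[1])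
open import Data.Nat.Coprimality using (Coprime; coprime-divisor)
open import Data.Fin using (Fin; zero; suc; toℕ; fromℕ; fromℕ<; punchIn; _≟_)
open import Data.Fin.Properties
  using ( any?; all?; pigeonhole; ¬∀⟶∃¬-smallest; suc-injective; punchInᵢ≢i
        ; toℕ-injective; toℕ<n; toℕ-fromℕ; toℕ-fromℕ<; toℕ-inject )
open import Data.Fin.Permutation using (Permutation; _⟨$⟩ʳ_)
open import Data.Vec.Functional using (removeAt)
open import Data.Product using (∃; _×_; _,_; map₂)
open import Data.Sum using (inj₁; inj₂)
open import Data.Empty using (⊥-elim)
open import Function using (_∘_; _∘′_; id; Inverse; mk↔ₛ′)
import Function.Consequences.Setoid as Consequences
import Function.Construct.Composition as Composition
open import Relation.Nullary using (Dec; yes; no; ¬_; contradiction)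
open import Relation.Nullary.Decidable using (map′; _×-dec_; ¬?; decidable-stable)
open import Relation.Unary using (Pred; Decidable)
open import Relation.Binary using (Rel; Setoid; IsEquivalence; IsDecEquivalence; _Respects_)
open import Relation.Binary.Definitions using (tri<; tri≈; tri>)
open import Relation.Binary.PropositionalEquality as ≡ using (_≡_; _≢_) renaming (setoid to ≡-setoid)
open import Algebra.Bundles using (Group)
open import Algebra.Morphism.Structures using (module GroupMorphisms)
open import Algebra.Morphism.Construct.Identity using (isGroupHomomorphism)
open import Algebra.Properties.Semiring.Sum +-*-semiring
  using (sum; sum-syntax; sum-cong-≗; ∑-comm; sum-remove; sum-permute; *-distribˡ-sum)
open import Defs

private variable
  a b p q ℓ ℓ′ : Level
  m n : ℕ

-- Counting over Fin n

indicator : ∀ {a} {A : Set a} → Dec A → ℕ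
indicator (yes _) = 1
indicator (no _)  = 0

indicator-no : ∀ {a} {A : Set a} (A? : Dec A) → ¬ A → indicator A? ≡ 0
indicator-no (yes a) ¬a = ⊥-elim (¬a a)
indicator-no (no _)  _  = ≡.refl

indicator≤1 : ∀ {a} {A : Set a} (A? : Dec A) → indicator A? ≤ 1
indicator≤1 (yes _) = s≤s z≤n
indicator≤1 (no _)  = z≤n

indicator-cong : ∀ {a b} {A : Set a} {B : Set b} (A? : Dec A) (B? : Dec B) →
                 (A → B) → (B → A) → indicator A? ≡ indicator B?
indicator-cong (yes _) (yes _) _   _   = ≡.refl
indicator-cong (yes a) (no ¬b) A⇒B _   = ⊥-elim (¬b (A⇒B a))
indicator-cong (no ¬a) (yes b) _   B⇒A = ⊥-elim (¬a (B⇒A b))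
indicator-cong (no _)  (no _)  _   _   = ≡.refl

count : {P : Pred (Fin n) p} → Decidable P → ℕ
count {n} P? = ∑[ i < n ] indicator (P? i)

count-cong : {P : Pred (Fin n) p} {Q : Pred (Fin n) q} (P? : Decidable P) (Q? : Decidable Q) →
             (∀ {i} → P i → Q i) → (∀ {i} → Q i → P i) → count P? ≡ count Q?
count-cong P? Q? P⇒Q Q⇒P = sum-cong-≗ λ i → indicator-cong (P? i) (Q? i) P⇒Q Q⇒P

count-none : {P : Pred (Fin n) p} (P? : Decidable P) → (∀ i → ¬ P i) → count P? ≡ 0
count-none {zero}  P? none = ≡.refl
count-none {suc n} P? none =
  ≡.cong₂ _+_ (indicator-no (P? zero) (none zero)) (count-none (P? ∘ suc) (none ∘ suc))

count-singleton : (i : Fin n) → count (i ≟_) ≡ 1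
count-singleton {suc n} zero    = ≡.cong suc (count-none {n} (λ j → zero ≟ suc j) λ _ ())
count-singleton {suc n} (suc i) =
  ≡.trans (count-cong {n} (λ j → suc i ≟ suc j) (i ≟_) suc-injective (≡.cong suc)) (count-singleton i)

count≤n : {P : Pred (Fin n) p} (P? : Decidable P) → count P? ≤ n
count≤n {zero}  P? = z≤n
count≤n {suc n} P? = +-mono-≤ (indicator≤1 (P? zero)) (count≤n (P? ∘ suc))

count<n : {P : Pred (Fin n) p} (P? : Decidable P) (i : Fin n) → ¬ P i → count P? < n
count<n P? zero    ¬Pi rewrite indicator-no (P? zero) ¬Pi = s≤s (count≤n (P? ∘ suc))
count<n P? (suc i) ¬Pi = +-mono-≤-< (indicator≤1 (P? zero)) (count<n (P? ∘ suc) i ¬Pi)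

count≡n⇒∀ : {P : Pred (Fin n) p} (P? : Decidable P) → count P? ≡ n → ∀ i → P i
count≡n⇒∀ P? count≡n i = decidable-stable (P? i) λ ¬Pi → <-irrefl count≡n (count<n P? i ¬Pi)

count-permute : {P : Pred (Fin n) p} (P? : Decidable P) (π : Permutation n n) →
                count (P? ∘ (π ⟨$⟩ʳ_)) ≡ count P?
count-permute P? π = ≡.sym (sum-permute _ π)

∑-const : ∀ n k → ∑[ i < n ] k ≡ n * k
∑-const zero    k = ≡.refl
∑-const (suc n) k = ≡.cong (k +_) (∑-const n k)

count-fibres : (f : Fin n → Fin m) → ∑[ c < m ] count (λ i → f i ≟ c) ≡ n
count-fibres {n} {m} f = begin
  ∑[ c < m ] ∑[ i < n ] indicator (f i ≟ c) ≡⟨ ∑-comm {n} {m} _ ⟨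
  ∑[ i < n ] count (f i ≟_)                  ≡⟨ sum-cong-≗ (count-singleton ∘ f) ⟩
  ∑[ i < n ] 1                               ≡⟨ ∑-const n 1 ⟩
  n * 1                                      ≡⟨ *-identityʳ n ⟩
  n                                          ∎
  where open ≡.≡-Reasoning

count-image : (g : Fin m → Fin n) → (∀ {j j′} → g j ≡ g j′ → j ≡ j′) →
              count (λ i → any? (λ j → g j ≟ i)) ≡ m
count-image g g-injective = ≡.trans (sum-cong-≗ fibre) (count-fibres g)
  where
  fibre : ∀ i → indicator (any? (λ j → g j ≟ i)) ≡ count (λ j → g j ≟ i)
  fibre i with any? (λ j → g j ≟ i)
  ... | yes (j , gj≡i) = ≡.sym (≡.trans
          (count-cong (λ j′ → g j′ ≟ i) (j ≟_) (λ gj′≡i → g-injective (≡.trans gj≡i (≡.sym gj′≡i)))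
                                               (λ { ≡.refl → gj≡i }))
          (count-singleton j))
  ... | no ∄j          = ≡.sym (count-none (λ j → g j ≟ i) (λ j gj≡i → ∄j (j , gj≡i)))

∣-sum : ∀ {d} (f : Fin n → ℕ) → (∀ i → d ∣ f i) → d ∣ sum f
∣-sum {zero}  f d∣f = _ ∣0
∣-sum {suc n} f d∣f = ∣m∣n⇒∣m+n (d∣f zero) (∣-sum (f ∘ suc) (d∣f ∘ suc))

∣-summand : ∀ {d} (f : Fin n → ℕ) (i : Fin n) → d ∣ sum f → (∀ j → j ≢ i → d ∣ f j) → d ∣ f i
∣-summand {suc n} {d} f i d∣∑ d∣others = ∣m+n∣m⇒∣n
  (≡.subst (d ∣_) (≡.trans (sum-remove {i = i} f) (+-comm (f i) _)) d∣∑)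
  (∣-sum (removeAt f i) (λ j → d∣others (punchIn i j) (punchInᵢ≢i i j)))

-- Arithmetic

least-witness : {Q : Pred ℕ q} → Decidable Q → ∀ {n} → Q n →
                ∃ λ m → Q m × (∀ {k} → k < m → ¬ Q k)
least-witness {Q = Q} Q? {n} Qn
  with i , ¬¬Qi , below ← ¬∀⟶∃¬-smallest (suc n) (λ i → ¬ Q (toℕ i)) (λ i → ¬? (Q? (toℕ i)))
                            (λ ∀¬Q → ∀¬Q (fromℕ n) (≡.subst Q (≡.sym (toℕ-fromℕ n)) Qn))
  = toℕ i , decidable-stable (Q? (toℕ i)) ¬¬Qi
  , λ k<i → ≡.subst (¬_ ∘ Q) (≡.trans (toℕ-inject (fromℕ< k<i)) (toℕ-fromℕ< k<i))
                    (below (fromℕ< k<i))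

∣p^k⇒p∣ : ∀ {p d} → Prime p → ∀ k → d ∣ p ^ k → d ≢ 1 → p ∣ d
∣p^k⇒p∣ p-prime zero    d∣1 d≢1 = ⊥-elim (d≢1 (∣1⇒≡1 d∣1))
∣p^k⇒p∣ {p} {d} p-prime (suc k) d∣p^[1+k] d≢1 with p ∣? d
... | yes p∣d = p∣d
... | no  p∤d = ∣p^k⇒p∣ p-prime k (coprime-divisor d⊥p d∣p^[1+k]) d≢1
  where
  d⊥p : Coprime d p
  d⊥p (i∣d , i∣p) with prime⇒irreducible p-prime i∣p
  ... | inj₁ i≡1   = i≡1
  ... | inj₂ ≡.refl = ⊥-elim (p∤d i∣d)

-- Finite setoids and their quotients

module _ {S : Setoid a ℓ} {T : Setoid b ℓ′} where
  open Setoid S using () renaming (Carrier to A; _≈_ to _≈₁_)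
  open Setoid T using () renaming (Carrier to B; _≈_ to _≈₂_)

  mk↔ₛ : (to : A → B) (from : B → A) →
         (∀ {x y} → x ≈₁ y → to x ≈₂ to y) → (∀ {x y} → x ≈₂ y → from x ≈₁ from y) →
         (∀ y → to (from y) ≈₂ y) → (∀ x → from (to x) ≈₁ x) → Inverse S T
  mk↔ₛ to from to-cong from-cong invˡ invʳ = record
    { to        = to
    ; from      = from
    ; to-cong   = to-cong
    ; from-cong = from-cong
    ; inverse   = strictlyInverseˡ⇒inverseˡ to-cong invˡ , strictlyInverseʳ⇒inverseʳ from-cong invʳ
    }
    where open Consequences S T

mk↔ₛ≡ : {S : Setoid a ℓ} {B : Set b} (to : Setoid.Carrier S → B) (from : B → Setoid.Carrier S) →
        (∀ {x y} → Setoid._≈_ S x y → to x ≡ to y) →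
        (∀ y → to (from y) ≡ y) → (∀ x → Setoid._≈_ S (from (to x)) x) → Inverse S (≡-setoid B)
mk↔ₛ≡ {S = S} to from to-cong = mk↔ₛ to from to-cong λ { ≡.refl → Setoid.refl S }

Finite : Setoid a ℓ → Set (a ⊔ ℓ)
Finite S = ∃ λ M → Inverse S (≡-setoid (Fin M))

coarsen : (S : Setoid a ℓ) {_∼_ : Rel (Setoid.Carrier S) ℓ′} → IsEquivalence _∼_ → Setoid a ℓ′
coarsen S {_∼_} isEq = record { Carrier = Setoid.Carrier S ; _≈_ = _∼_ ; isEquivalence = isEq }

Fin-quotient-finite : ∀ n {_∼_ : Rel (Fin n) ℓ} (isDecEq : IsDecEquivalence _∼_) →
                      Finite (coarsen (≡-setoid (Fin n)) (IsDecEquivalence.isEquivalence isDecEq))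
Fin-quotient-finite zero    isDecEq = 0 , mk↔ₛ≡ (λ ()) (λ ()) (λ { {()} }) (λ ()) (λ ())
Fin-quotient-finite (suc n) {_∼_} isDecEq
  with Fin-quotient-finite n isDecEq⁺ | any? (λ j → zero ∼? suc j)
  where
  open IsDecEquivalence isDecEq renaming (_≟_ to _∼?_)
  isDecEq⁺ : IsDecEquivalence (λ i j → suc i ∼ suc j)
  isDecEq⁺ = record
    { isEquivalence = record { refl = refl ; sym = sym ; trans = trans }
    ; _≟_           = λ i j → suc i ∼? suc j
    }
... | M , φ | yes (j , 0∼j) = M , mk↔ₛ≡ to (suc ∘ φ.from) to-cong φ.strictlyInverseˡ invʳ
  where
  module φ = Inverse φ
  open IsDecEquivalence isDecEq
  to : Fin (suc n) → Fin M
  to zero    = φ.to j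
  to (suc i) = φ.to i
  to-cong : ∀ {x y} → x ∼ y → to x ≡ to y
  to-cong {zero}  {zero}  _   = ≡.refl
  to-cong {zero}  {suc i} 0∼i = φ.to-cong (trans (sym 0∼j) 0∼i)
  to-cong {suc i} {zero}  i∼0 = φ.to-cong (trans i∼0 0∼j)
  to-cong {suc i} {suc _} i∼k = φ.to-cong i∼k
  invʳ : ∀ x → suc (φ.from (to x)) ∼ x
  invʳ zero    = trans (φ.strictlyInverseʳ j) (sym 0∼j)
  invʳ (suc i) = φ.strictlyInverseʳ i
... | M , φ | no 0≁suc = suc M , mk↔ₛ≡ to from to-cong invˡ invʳ
  where
  module φ = Inverse φ
  open IsDecEquivalence isDecEq
  to : Fin (suc n) → Fin (suc M)
  to zero    = zero
  to (suc i) = suc (φ.to i)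
  from : Fin (suc M) → Fin (suc n)
  from zero    = zero
  from (suc k) = suc (φ.from k)
  to-cong : ∀ {x y} → x ∼ y → to x ≡ to y
  to-cong {zero}  {zero}  _   = ≡.refl
  to-cong {zero}  {suc i} 0∼i = ⊥-elim (0≁suc (i , 0∼i))
  to-cong {suc i} {zero}  i∼0 = ⊥-elim (0≁suc (i , sym i∼0))
  to-cong {suc i} {suc _} i∼k = ≡.cong suc (φ.to-cong i∼k)
  invˡ : ∀ k → to (from k) ≡ k
  invˡ zero    = ≡.refl
  invˡ (suc k) = ≡.cong suc (φ.strictlyInverseˡ k)
  invʳ : ∀ x → from (to x) ∼ x
  invʳ zero    = refl
  invʳ (suc i) = φ.strictlyInverseʳ i

module _ (S : Setoid a ℓ) {_∼_ : Rel (Setoid.Carrier S) ℓ′} (isDecEq : IsDecEquivalence _∼_) where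
  open Setoid S
  private module ∼ = IsDecEquivalence isDecEq

  quotient-finite : (∀ {x y} → x ≈ y → x ∼ y) → Finite S → Finite (coarsen S ∼.isEquivalence)
  quotient-finite ≈⇒∼ (N , ι) = map₂ (Composition.inverse ψ) (Fin-quotient-finite N isDecEqᴺ)
    where
    module ι = Inverse ι
    isDecEqᴺ : IsDecEquivalence (λ i j → ι.from i ∼ ι.from j)
    isDecEqᴺ = record
      { isEquivalence = record { refl = ∼.refl ; sym = ∼.sym ; trans = ∼.trans }
      ; _≟_           = λ i j → ι.from i ∼.≟ ι.from j
      }
    from-to : ∀ x → ι.from (ι.to x) ∼ x
    from-to x = ≈⇒∼ (ι.strictlyInverseʳ x)
    ψ : Inverse (coarsen S ∼.isEquivalence)
                (coarsen (≡-setoid (Fin N)) (IsDecEquivalence.isEquivalence isDecEqᴺ))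
    ψ = mk↔ₛ ι.to ι.from (λ x∼y → ∼.trans (from-to _) (∼.trans x∼y (∼.sym (from-to _)))) id
             (from-to ∘ ι.from) from-to

module FiniteSetoid (S : Setoid a ℓ) {N} (ι : Inverse S (≡-setoid (Fin N))) where
  open Setoid S
  module ι = Inverse ι

  ι-injective : ∀ {x y} → ι.to x ≡ ι.to y → x ≈ y
  ι-injective {x} {y} eq =
    trans (sym (ι.strictlyInverseʳ x)) (trans (ι.from-cong eq) (ι.strictlyInverseʳ y))

  infix 4 _≈?_
  _≈?_ : ∀ x y → Dec (x ≈ y)
  x ≈? y = map′ ι-injective ι.to-cong (ι.to x ≟ ι.to y)

  # : {P : Pred Carrier p} → Decidable P → ℕ
  # P? = count (P? ∘ ι.from)

  module _ {P : Pred Carrier p} (P-resp : P Respects _≈_) (P? : Decidable P) where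

    ∀? : Dec (∀ x → P x)
    ∀? = map′ (λ ∀i x → P-resp (ι.strictlyInverseʳ x) (∀i (ι.to x))) (λ ∀x → ∀x ∘ ι.from)
              (all? (P? ∘ ι.from))

    ∃? : Dec (∃ P)
    ∃? = map′ (λ { (i , Pi) → ι.from i , Pi })
              (λ { (x , Px) → ι.to x , P-resp (sym (ι.strictlyInverseʳ x)) Px })
              (any? (P? ∘ ι.from))

  module _ {_∼_ : Rel Carrier ℓ′} (isDecEq : IsDecEquivalence _∼_) (≈⇒∼ : ∀ {x y} → x ≈ y → x ∼ y) where
    open IsDecEquivalence isDecEq using () renaming (_≟_ to _∼?_)

    ∑-class-sizes : ∀ {M} (φ : Inverse (coarsen S (IsDecEquivalence.isEquivalence isDecEq))
                                       (≡-setoid (Fin M))) →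
                    N ≡ ∑[ c < M ] # (Inverse.from φ c ∼?_)
    ∑-class-sizes {M} φ = ≡.trans (≡.sym (count-fibres (φ.to ∘ ι.from))) (sum-cong-≗ λ c →
      count-cong (λ i → φ.to (ι.from i) ≟ c) (λ i → φ.from c ∼? ι.from i)
        (λ { ≡.refl → φ.strictlyInverseʳ _ })
        (λ c∼x → ≡.trans (≡.sym (φ.to-cong c∼x)) (φ.strictlyInverseˡ c)))
      where module φ = Inverse φ

-- Groups: powers, conjugation, subgroups and quotients

module GroupTheory {c ℓ} (G : Group c ℓ) where
  open Group G
  open import Algebra.Properties.Group G public
  import Algebra.Properties.Monoid.Mult monoid as Mult
  open import Relation.Binary.Reasoning.Setoid setoid

  infixr 8 _^ᵍ_
  _^ᵍ_ : Carrier → ℕ → Carrier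
  x ^ᵍ k = pow G x k

  ^ᵍ-+ : ∀ x i j → x ^ᵍ (i + j) ≈ x ^ᵍ i ∙ x ^ᵍ j
  ^ᵍ-+ = Mult.×-homo-+

  ^ᵍ-* : ∀ x i j → (x ^ᵍ i) ^ᵍ j ≈ x ^ᵍ (j * i)
  ^ᵍ-* x i j = Mult.×-assocˡ x j i

  ^ᵍ-congˡ : ∀ {x y} k → x ≈ y → x ^ᵍ k ≈ y ^ᵍ k
  ^ᵍ-congˡ k = Mult.×-congʳ k

  ε^ᵍ : ∀ k → ε ^ᵍ k ≈ ε
  ε^ᵍ zero    = refl
  ε^ᵍ (suc k) = trans (identityˡ _) (ε^ᵍ k)

  ^ᵍ-comm : ∀ x i j → (x ^ᵍ i) ^ᵍ j ≈ (x ^ᵍ j) ^ᵍ i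
  ^ᵍ-comm x i j = begin
    (x ^ᵍ i) ^ᵍ j ≈⟨ ^ᵍ-* x i j ⟩
    x ^ᵍ (j * i)  ≡⟨ ≡.cong (x ^ᵍ_) (*-comm j i) ⟩
    x ^ᵍ (i * j)  ≈⟨ ^ᵍ-* x j i ⟨
    (x ^ᵍ j) ^ᵍ i ∎

  ^ᵍ-multiple : ∀ {x d q} → x ^ᵍ d ≈ ε → d ∣ q → x ^ᵍ q ≈ ε
  ^ᵍ-multiple {x} {d} xᵈ≈ε (divides e ≡.refl) = begin
    x ^ᵍ (e * d)  ≈⟨ ^ᵍ-* x d e ⟨
    (x ^ᵍ d) ^ᵍ e ≈⟨ ^ᵍ-congˡ e xᵈ≈ε ⟩
    ε ^ᵍ e        ≈⟨ ε^ᵍ e ⟩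
    ε             ∎

  ^ᵍ-collision : ∀ x {i j} → i < j → x ^ᵍ i ≈ x ^ᵍ j → x ^ᵍ (j ∸ i) ≈ ε
  ^ᵍ-collision x {i} {j} i<j xⁱ≈xʲ = identityʳ-unique (x ^ᵍ i) _ (begin
    x ^ᵍ i ∙ x ^ᵍ (j ∸ i) ≈⟨ ^ᵍ-+ x i (j ∸ i) ⟨
    x ^ᵍ (i + (j ∸ i))    ≡⟨ ≡.cong (x ^ᵍ_) (m+[n∸m]≡n (<⇒≤ i<j)) ⟩
    x ^ᵍ j                ≈⟨ xⁱ≈xʲ ⟨
    x ^ᵍ i                ∎)

  Central : Carrier → Set (c ⊔ ℓ)
  Central x = ∀ g → g ∙ x ≈ x ∙ g

  central-resp-≈ : Central Respects _≈_
  central-resp-≈ x≈y cx g = trans (∙-congˡ (sym x≈y)) (trans (cx g) (∙-congʳ x≈y))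

  central-ε : Central ε
  central-ε g = trans (identityʳ g) (sym (identityˡ g))

  central-∙ : ∀ {x y} → Central x → Central y → Central (x ∙ y)
  central-∙ {x} {y} cx cy g = begin
    g ∙ (x ∙ y) ≈⟨ assoc g x y ⟨
    g ∙ x ∙ y   ≈⟨ ∙-congʳ (cx g) ⟩
    x ∙ g ∙ y   ≈⟨ assoc x g y ⟩
    x ∙ (g ∙ y) ≈⟨ ∙-congˡ (cy g) ⟩
    x ∙ (y ∙ g) ≈⟨ assoc x y g ⟨
    x ∙ y ∙ g   ∎

  central-^ᵍ : ∀ {x} → Central x → ∀ k → Central (x ^ᵍ k)
  central-^ᵍ cx zero    = central-ε
  central-^ᵍ cx (suc k) = central-∙ cx (central-^ᵍ cx k)

  ^ᵍ-distrib-central : ∀ h {z} → Central z → ∀ k → (h ∙ z) ^ᵍ k ≈ h ^ᵍ k ∙ z ^ᵍ k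
  ^ᵍ-distrib-central h cz zero    = sym (identityˡ ε)
  ^ᵍ-distrib-central h {z} cz (suc k) = begin
    h ∙ z ∙ (h ∙ z) ^ᵍ k         ≈⟨ ∙-congˡ (^ᵍ-distrib-central h cz k) ⟩
    h ∙ z ∙ (h ^ᵍ k ∙ z ^ᵍ k)     ≈⟨ assoc h z _ ⟩
    h ∙ (z ∙ (h ^ᵍ k ∙ z ^ᵍ k))   ≈⟨ ∙-congˡ (assoc z _ _) ⟨
    h ∙ (z ∙ h ^ᵍ k ∙ z ^ᵍ k)     ≈⟨ ∙-congˡ (∙-congʳ (cz (h ^ᵍ k))) ⟨
    h ∙ (h ^ᵍ k ∙ z ∙ z ^ᵍ k)     ≈⟨ ∙-congˡ (assoc _ z _) ⟩
    h ∙ (h ^ᵍ k ∙ (z ∙ z ^ᵍ k))   ≈⟨ assoc h _ _ ⟨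
    h ∙ h ^ᵍ k ∙ (z ∙ z ^ᵍ k)     ∎

  conj : Carrier → Carrier → Carrier
  conj g x = g ∙ x ∙ g ⁻¹

  conj-cong : ∀ {g g′ x x′} → g ≈ g′ → x ≈ x′ → conj g x ≈ conj g′ x′
  conj-cong g≈g′ x≈x′ = ∙-cong (∙-cong g≈g′ x≈x′) (⁻¹-cong g≈g′)

  conj-resp : ∀ {x y} → (λ g → conj g x ≈ y) Respects _≈_
  conj-resp g≈h gx≈y = trans (conj-cong (sym g≈h) refl) gx≈y

  conj-ε : ∀ x → conj ε x ≈ x
  conj-ε x = trans (∙-cong (identityˡ x) ε⁻¹≈ε) (identityʳ x)

  conj-∙ : ∀ g h x → conj (g ∙ h) x ≈ conj g (conj h x)
  conj-∙ g h x = begin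
    g ∙ h ∙ x ∙ (g ∙ h) ⁻¹      ≈⟨ ∙-cong (assoc g h x) (⁻¹-anti-homo-∙ g h) ⟩
    g ∙ (h ∙ x) ∙ (h ⁻¹ ∙ g ⁻¹) ≈⟨ assoc _ _ _ ⟨
    g ∙ (h ∙ x) ∙ h ⁻¹ ∙ g ⁻¹   ≈⟨ ∙-congʳ (assoc g _ _) ⟩
    g ∙ (h ∙ x ∙ h ⁻¹) ∙ g ⁻¹   ∎

  conj-inverse : ∀ g x → conj (g ⁻¹) (conj g x) ≈ x
  conj-inverse g x = begin
    conj (g ⁻¹) (conj g x) ≈⟨ conj-∙ (g ⁻¹) g x ⟨
    conj (g ⁻¹ ∙ g) x      ≈⟨ conj-cong (inverseˡ g) refl ⟩
    conj ε x               ≈⟨ conj-ε x ⟩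
    x                      ∎

  conj-fixed⇒commute : ∀ {g x} → conj g x ≈ x → g ∙ x ≈ x ∙ g
  conj-fixed⇒commute {g} {x} fixed = trans (sym (//-rightDividesˡ g (g ∙ x))) (∙-congʳ fixed)

  central⇒conj-fixed : ∀ {x} → Central x → ∀ g → conj g x ≈ x
  central⇒conj-fixed {x} cx g = trans (∙-congʳ (cx g)) (//-rightDividesʳ g x)

  same-conj⇒stabilises : ∀ {a g x} → conj g x ≈ conj a x → conj (a \\ g) x ≈ x
  same-conj⇒stabilises {a} {g} {x} gx≈ax = begin
    conj (a ⁻¹ ∙ g) x       ≈⟨ conj-∙ (a ⁻¹) g x ⟩
    conj (a ⁻¹) (conj g x)  ≈⟨ conj-cong refl gx≈ax ⟩
    conj (a ⁻¹) (conj a x)  ≈⟨ conj-inverse a x ⟩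
    x                       ∎

  stabilises⇒same-conj : ∀ {a g x} → conj (a \\ g) x ≈ x → conj g x ≈ conj a x
  stabilises⇒same-conj {a} {g} {x} fixed = begin
    conj g x                 ≈⟨ conj-cong (\\-leftDividesˡ a g) refl ⟨
    conj (a ∙ (a \\ g)) x    ≈⟨ conj-∙ a _ x ⟩
    conj a (conj (a \\ g) x) ≈⟨ conj-cong refl fixed ⟩
    conj a x                 ∎

  infix 4 _∼ᶜ_
  _∼ᶜ_ : Rel Carrier (c ⊔ ℓ)
  x ∼ᶜ y = ∃ λ g → conj g x ≈ y

  ≈⇒∼ᶜ : ∀ {x y} → x ≈ y → x ∼ᶜ y
  ≈⇒∼ᶜ {x} x≈y = ε , trans (conj-ε x) x≈y

  ∼ᶜ-isEquivalence : IsEquivalence _∼ᶜ_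
  ∼ᶜ-isEquivalence = record
    { refl  = ≈⇒∼ᶜ refl
    ; sym   = λ { {x} (g , gx≈y) → g ⁻¹ , trans (conj-cong refl (sym gx≈y)) (conj-inverse g x) }
    ; trans = λ { {x} (g , gx≈y) (h , hy≈w) →
                  h ∙ g , trans (conj-∙ h g x) (trans (conj-cong refl gx≈y) hy≈w) }
    }

  record IsSubgroup {ℓ′} (H : Pred Carrier ℓ′) : Set (c ⊔ ℓ ⊔ ℓ′) where
    field
      resp-≈    : H Respects _≈_
      ε∈        : H ε
      ∙-closed  : ∀ {x y} → H x → H y → H (x ∙ y)
      ⁻¹-closed : ∀ {x} → H x → H (x ⁻¹)

  IsNormal : ∀ {ℓ′} → Pred Carrier ℓ′ → Set (c ⊔ ℓ′)
  IsNormal H = ∀ g {h} → H h → H (conj g h)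

  central⇒normal : ∀ {ℓ′} {H : Pred Carrier ℓ′} → IsSubgroup H → (∀ {h} → H h → Central h) → IsNormal H
  central⇒normal H-sub central g h∈H =
    IsSubgroup.resp-≈ H-sub (sym (central⇒conj-fixed (central h∈H) g)) h∈H

  module Cosets {ℓ′} {H : Pred Carrier ℓ′} (H-sub : IsSubgroup H) where
    open IsSubgroup H-sub

    infix 4 _∼_
    _∼_ : Rel Carrier ℓ′
    x ∼ y = H (x \\ y)

    ≈⇒∼ : ∀ {x y} → x ≈ y → x ∼ y
    ≈⇒∼ {x} x≈y = resp-≈ (trans (sym (inverseˡ x)) (∙-congˡ x≈y)) ε∈

    ∼-isEquivalence : IsEquivalence _∼_
    ∼-isEquivalence = record
      { refl  = ≈⇒∼ refl
      ; sym   = λ {x} {y} x∼y → resp-≈ (swap x y) (⁻¹-closed x∼y)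
      ; trans = λ {x} {y} {z} x∼y y∼z → resp-≈ (compose x y z) (∙-closed x∼y y∼z)
      }
      where
      swap : ∀ x y → (x \\ y) ⁻¹ ≈ y \\ x
      swap x y = begin
        (x ⁻¹ ∙ y) ⁻¹      ≈⟨ ⁻¹-anti-homo-∙ (x ⁻¹) y ⟩
        y ⁻¹ ∙ x ⁻¹ ⁻¹     ≈⟨ ∙-congˡ (⁻¹-involutive x) ⟩
        y ⁻¹ ∙ x           ∎
      compose : ∀ x y z → (x \\ y) ∙ (y \\ z) ≈ x \\ z
      compose x y z = begin
        x ⁻¹ ∙ y ∙ (y ⁻¹ ∙ z)  ≈⟨ assoc (x ⁻¹) y _ ⟩
        x ⁻¹ ∙ (y ∙ (y \\ z)) ≈⟨ ∙-congˡ (\\-leftDividesˡ y z) ⟩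
        x ⁻¹ ∙ z               ∎

  module _ {H : Pred Carrier ℓ} (H-sub : IsSubgroup H) (H-normal : IsNormal H) where
    open Cosets H-sub
    open IsSubgroup H-sub

    quotientGroup : Group c ℓ
    quotientGroup = record
      { Carrier = Carrier
      ; _≈_     = _∼_
      ; _∙_     = _∙_
      ; ε       = ε
      ; _⁻¹     = _⁻¹
      ; isGroup = record
        { isMonoid = record
          { isSemigroup = record
            { isMagma = record { isEquivalence = ∼-isEquivalence ; ∙-cong = ∙-cong∼ }
            ; assoc   = λ x y z → ≈⇒∼ (assoc x y z)
            }
          ; identity = (λ x → ≈⇒∼ (identityˡ x)) , (λ x → ≈⇒∼ (identityʳ x))
          }
        ; inverse = (λ x → ≈⇒∼ (inverseˡ x)) , (λ x → ≈⇒∼ (inverseʳ x))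
        ; ⁻¹-cong = ⁻¹-cong∼
        }
      }
      where
      ∙-cong∼ : ∀ {x x′ y y′} → x ∼ x′ → y ∼ y′ → x ∙ y ∼ x′ ∙ y′
      ∙-cong∼ {x} {x′} {y} {y′} x∼x′ y∼y′ = resp-≈ (begin
        conj (y ⁻¹) (x \\ x′) ∙ (y \\ y′)  ≈⟨ ∙-congʳ (∙-congˡ (⁻¹-involutive y)) ⟩
        y ⁻¹ ∙ (x \\ x′) ∙ y ∙ (y \\ y′)    ≈⟨ assoc _ y _ ⟩
        y ⁻¹ ∙ (x \\ x′) ∙ (y ∙ (y \\ y′))  ≈⟨ ∙-congˡ (\\-leftDividesˡ y y′) ⟩
        y ⁻¹ ∙ (x ⁻¹ ∙ x′) ∙ y′             ≈⟨ ∙-congʳ (assoc (y ⁻¹) (x ⁻¹) x′) ⟨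
        y ⁻¹ ∙ x ⁻¹ ∙ x′ ∙ y′               ≈⟨ ∙-congʳ (∙-congʳ (⁻¹-anti-homo-∙ x y)) ⟨
        (x ∙ y) ⁻¹ ∙ x′ ∙ y′                ≈⟨ assoc _ x′ y′ ⟩
        (x ∙ y) \\ (x′ ∙ y′)                ∎) (∙-closed (H-normal (y ⁻¹) x∼x′) y∼y′)
      ⁻¹-cong∼ : ∀ {x y} → x ∼ y → x ⁻¹ ∼ y ⁻¹
      ⁻¹-cong∼ {x} {y} x∼y = resp-≈ (begin
        conj x ((x \\ y) ⁻¹)      ≈⟨ assoc x _ _ ⟩
        x ∙ ((x \\ y) ⁻¹ ∙ x ⁻¹)  ≈⟨ ∙-congˡ (⁻¹-anti-homo-∙ x (x \\ y)) ⟨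
        x ∙ (x ∙ (x \\ y)) ⁻¹     ≈⟨ ∙-congˡ (⁻¹-cong (\\-leftDividesˡ x y)) ⟩
        x ∙ y ⁻¹                  ≈⟨ ∙-congʳ (⁻¹-involutive x) ⟨
        x ⁻¹ \\ y ⁻¹              ∎) (H-normal x (⁻¹-closed x∼y))

    ^ᵍ-quotient : ∀ x k → pow quotientGroup x k ≡ x ^ᵍ k
    ^ᵍ-quotient x zero    = ≡.refl
    ^ᵍ-quotient x (suc k) = ≡.cong (x ∙_) (^ᵍ-quotient x k)

    hom-from-quotient : ∀ {c′ ℓ′} (K : Group c′ ℓ′) {f : Carrier → Group.Carrier K} →
                        IsGroupHom quotientGroup K f → IsGroupHom G K f
    hom-from-quotient K hom = record
      { isMonoidHomomorphism = record
        { isMagmaHomomorphism = record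
          { isRelHomomorphism = record { cong = ⟦⟧-cong ∘′ ≈⇒∼ }
          ; homo              = homo
          }
        ; ε-homo = ε-homo
        }
      ; ⁻¹-homo = ⁻¹-homo
      }
      where open GroupMorphisms.IsGroupHomomorphism hom

  record IsOrderOf (x : Carrier) (d : ℕ) : Set ℓ where
    field
      {{nonZero}} : NonZero d
      ^order≈ε    : x ^ᵍ d ≈ ε
      minimal     : ∀ {i} → 0 < i → i < d → x ^ᵍ i ≉ ε

  order≢1 : ∀ {y d} → IsOrderOf y d → y ≉ ε → d ≢ 1
  order≢1 order y≉ε ≡.refl = y≉ε (trans (sym (identityʳ _)) (IsOrderOf.^order≈ε order))

  order-of-power : ∀ {y} p e → IsOrderOf y (p * e) → IsOrderOf (y ^ᵍ e) p
  order-of-power {y} p e order = record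
    { nonZero  = m*n≢0⇒m≢0 p
    ; ^order≈ε = trans (^ᵍ-* y e p) ^order≈ε
    ; minimal  = λ {i} 0<i i<p yᵉⁱ≈ε →
                   minimal (0<i*e 0<i) (*-monoˡ-< e i<p) (trans (sym (^ᵍ-* y e i)) yᵉⁱ≈ε)
    }
    where
    open IsOrderOf order
    instance
      e≢0 : NonZero e
      e≢0 = m*n≢0⇒n≢0 p
    0<i*e : ∀ {i} → 0 < i → 0 < i * e
    0<i*e {i} 0<i = >-nonZero⁻¹ (i * e) {{m*n≢0 i e {{>-nonZero 0<i}}}}

  infix 4 _∈⟨_⟩
  _∈⟨_⟩ : Carrier → Carrier → Set ℓ
  y ∈⟨ z ⟩ = ∃ λ i → y ≈ z ^ᵍ i

  ∈⟨⟩-exponent : ∀ {y z d q} → z ^ᵍ d ≈ ε → d ∣ q → y ∈⟨ z ⟩ → y ^ᵍ q ≈ ε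
  ∈⟨⟩-exponent {y} {z} {q = q} zᵈ≈ε d∣q (i , y≈zⁱ) = begin
    y ^ᵍ q          ≈⟨ ^ᵍ-congˡ q y≈zⁱ ⟩
    (z ^ᵍ i) ^ᵍ q   ≈⟨ ^ᵍ-comm z i q ⟩
    (z ^ᵍ q) ^ᵍ i   ≈⟨ ^ᵍ-congˡ i (^ᵍ-multiple zᵈ≈ε d∣q) ⟩
    ε ^ᵍ i          ≈⟨ ε^ᵍ i ⟩
    ε               ∎

  ∈⟨central⟩⇒central : ∀ {y z} → Central z → y ∈⟨ z ⟩ → Central y
  ∈⟨central⟩⇒central cz (i , y≈zⁱ) = central-resp-≈ (sym y≈zⁱ) (central-^ᵍ cz i)

  module _ {z d} (order : IsOrderOf z d) where
    open IsOrderOf order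

    ^ᵍ-mod : ∀ i → z ^ᵍ i ≈ z ^ᵍ (i % d)
    ^ᵍ-mod i = begin
      z ^ᵍ i                             ≡⟨ ≡.cong (z ^ᵍ_) (m≡m%n+[m/n]*n i d) ⟩
      z ^ᵍ (i % d + (i / d) * d)         ≈⟨ ^ᵍ-+ z (i % d) _ ⟩
      z ^ᵍ (i % d) ∙ z ^ᵍ ((i / d) * d)  ≈⟨ ∙-congˡ (^ᵍ-* z d (i / d)) ⟨
      z ^ᵍ (i % d) ∙ (z ^ᵍ d) ^ᵍ (i / d) ≈⟨ ∙-congˡ (^ᵍ-congˡ (i / d) ^order≈ε) ⟩
      z ^ᵍ (i % d) ∙ ε ^ᵍ (i / d)        ≈⟨ ∙-congˡ (ε^ᵍ (i / d)) ⟩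
      z ^ᵍ (i % d) ∙ ε                   ≈⟨ identityʳ _ ⟩
      z ^ᵍ (i % d)                       ∎

    ^ᵍ-distinct : ∀ {i j} → i < j → j < d → z ^ᵍ i ≉ z ^ᵍ j
    ^ᵍ-distinct {i} {j} i<j j<d zⁱ≈zʲ =
      minimal (m<n⇒0<n∸m i<j) (≤-<-trans (m∸n≤m j i) j<d) (^ᵍ-collision z i<j zⁱ≈zʲ)

    ^ᵍ-injective : ∀ {i j} → i < d → j < d → z ^ᵍ i ≈ z ^ᵍ j → i ≡ j
    ^ᵍ-injective {i} {j} i<d j<d zⁱ≈zʲ with <-cmp i j
    ... | tri< i<j _ _ = ⊥-elim (^ᵍ-distinct i<j j<d zⁱ≈zʲ)
    ... | tri≈ _ i≡j _ = i≡j
    ... | tri> _ _ j<i = ⊥-elim (^ᵍ-distinct j<i i<d (sym zⁱ≈zʲ))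

    ⟨⟩-isSubgroup : IsSubgroup (_∈⟨ z ⟩)
    ⟨⟩-isSubgroup = record
      { resp-≈    = λ { x≈y (i , x≈zⁱ) → i , trans (sym x≈y) x≈zⁱ }
      ; ε∈        = 0 , refl
      ; ∙-closed  = λ { (i , x≈zⁱ) (j , y≈zʲ) → i + j , trans (∙-cong x≈zⁱ y≈zʲ) (sym (^ᵍ-+ z i j)) }
      ; ⁻¹-closed = λ { (i , x≈zⁱ) → pred d * i , trans (⁻¹-cong x≈zⁱ) (sym (inverse-^ᵍ i)) }
      }
      where
      inverse-^ᵍ : ∀ i → z ^ᵍ (pred d * i) ≈ (z ^ᵍ i) ⁻¹
      inverse-^ᵍ i = inverseʳ-unique (z ^ᵍ i) _ (begin
        z ^ᵍ i ∙ z ^ᵍ (pred d * i) ≈⟨ ^ᵍ-+ z i _ ⟨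
        z ^ᵍ (suc (pred d) * i)    ≡⟨ ≡.cong (λ n → z ^ᵍ (n * i)) (suc-pred d) ⟩
        z ^ᵍ (d * i)               ≡⟨ ≡.cong (z ^ᵍ_) (*-comm d i) ⟩
        z ^ᵍ (i * d)               ≈⟨ ^ᵍ-* z d i ⟨
        (z ^ᵍ d) ^ᵍ i              ≈⟨ ^ᵍ-congˡ i ^order≈ε ⟩
        ε ^ᵍ i                     ≈⟨ ε^ᵍ i ⟩
        ε                          ∎)

    ⟨⟩-isNormal : Central z → IsNormal (_∈⟨ z ⟩)
    ⟨⟩-isNormal cz = central⇒normal ⟨⟩-isSubgroup (∈⟨central⟩⇒central cz)

    G/⟨z⟩ : Central z → Group c ℓ
    G/⟨z⟩ cz = quotientGroup ⟨⟩-isSubgroup (⟨⟩-isNormal cz)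

-- Finite groups: Lagrange, orbit–stabiliser and the centre of a p-group

module FiniteGroup {c ℓ} (G : Group c ℓ) {N} (ι : HasOrder G N) where
  open Group G
  open GroupTheory G
  open FiniteSetoid setoid ι

  #-translate : {P : Pred Carrier p} → P Respects _≈_ → (P? : Decidable P) →
                ∀ a → # (λ g → P? (a ∙ g)) ≡ # P?
  #-translate P-resp P? a = ≡.trans
    (count-cong (λ i → P? (a ∙ ι.from i)) (λ i → P? (ι.from (ι.to (a ∙ ι.from i))))
      (P-resp (sym (ι.strictlyInverseʳ _))) (P-resp (ι.strictlyInverseʳ _)))
    (count-permute (P? ∘ ι.from) π)
    where
    π : Permutation N N
    π = mk↔ₛ′ (λ i → ι.to (a ∙ ι.from i)) (λ i → ι.to (a \\ ι.from i))
      (λ i → ≡.trans (ι.to-cong (trans (∙-congˡ (ι.strictlyInverseʳ _)) (\\-leftDividesˡ a _)))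
                     (ι.strictlyInverseˡ i))
      (λ i → ≡.trans (ι.to-cong (trans (∙-congˡ (ι.strictlyInverseʳ _)) (\\-leftDividesʳ a _)))
                     (ι.strictlyInverseˡ i))

  module _ {H : Pred Carrier ℓ} (H-sub : IsSubgroup H) (H? : Decidable H) where
    open Cosets H-sub
    open IsSubgroup H-sub

    coset-isDecEquivalence : IsDecEquivalence _∼_
    coset-isDecEquivalence = record { isEquivalence = ∼-isEquivalence ; _≟_ = λ x y → H? (x \\ y) }

    lagrange : ∃ λ M → Inverse (coarsen setoid ∼-isEquivalence) (≡-setoid (Fin M)) × N ≡ M * # H?
    lagrange with M , φ ← quotient-finite setoid coset-isDecEquivalence ≈⇒∼ (N , ι) = M , φ , (begin
      N                                       ≡⟨ ∑-class-sizes coset-isDecEquivalence ≈⇒∼ φ ⟩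
      ∑[ c < M ] # (λ g → H? (rep c \\ g))   ≡⟨ sum-cong-≗ (coset-size ∘ rep) ⟩
      ∑[ c < M ] # H?                         ≡⟨ ∑-const M (# H?) ⟩
      M * # H?                                ∎)
      where
      open ≡.≡-Reasoning
      rep : Fin M → Carrier
      rep = Inverse.from φ
      coset-size : ∀ r → # (λ g → H? (r \\ g)) ≡ # H?
      coset-size r = ≡.trans (≡.sym (#-translate (λ x≈y → resp-≈ (∙-congˡ x≈y)) (λ g → H? (r \\ g)) r))
        (count-cong _ (H? ∘ ι.from) (resp-≈ (\\-leftDividesʳ r _)) (resp-≈ (sym (\\-leftDividesʳ r _))))

  order-exists : ∀ x → ∃ λ d → IsOrderOf x d
  order-exists x =
    let i , j , i<j , xⁱ≡xʲ = pigeonhole (n<1+n N) (λ (t : Fin (suc N)) → ι.to (x ^ᵍ toℕ t))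
        d , (0<d , xᵈ≈ε) , below = least-witness (λ n → (0 <? n) ×-dec (x ^ᵍ n ≈? ε))
                                     (m<n⇒0<n∸m i<j , ^ᵍ-collision x i<j (ι-injective xⁱ≡xʲ))
    in d , record { nonZero  = >-nonZero 0<d
                  ; ^order≈ε = xᵈ≈ε
                  ; minimal  = λ 0<i i<d xⁱ≈ε → below i<d (0<i , xⁱ≈ε)
                  }

  module _ {z d} (order : IsOrderOf z d) where
    open IsOrderOf order

    ∈⟨⟩⇒power-below-order : ∀ {y} → y ∈⟨ z ⟩ → ∃ λ (j : Fin d) → y ≈ z ^ᵍ toℕ j
    ∈⟨⟩⇒power-below-order (i , y≈zⁱ) = fromℕ< (m%n<n i d) ,
      trans y≈zⁱ (trans (^ᵍ-mod order i) (reflexive (≡.cong (z ^ᵍ_) (≡.sym (toℕ-fromℕ< (m%n<n i d))))))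

    ∈⟨⟩? : Decidable (_∈⟨ z ⟩)
    ∈⟨⟩? y = map′ (λ { (j , y≈zʲ) → toℕ j , y≈zʲ }) ∈⟨⟩⇒power-below-order (any? λ j → y ≈? z ^ᵍ toℕ j)

    #⟨⟩≡order : # ∈⟨⟩? ≡ d
    #⟨⟩≡order = ≡.trans
      (count-cong (∈⟨⟩? ∘ ι.from) (λ i → any? (λ j → power j ≟ i)) to-power from-power)
      (count-image power power-injective)
      where
      power : Fin d → Fin N
      power j = ι.to (z ^ᵍ toℕ j)
      power-injective : ∀ {j j′} → power j ≡ power j′ → j ≡ j′
      power-injective eq = toℕ-injective (^ᵍ-injective order (toℕ<n _) (toℕ<n _) (ι-injective eq))
      to-power : ∀ {i} → ι.from i ∈⟨ z ⟩ → ∃ λ j → power j ≡ i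
      to-power {i} y∈ with j , y≈zʲ ← ∈⟨⟩⇒power-below-order y∈ =
        j , ≡.trans (ι.to-cong (sym y≈zʲ)) (ι.strictlyInverseˡ i)
      from-power : ∀ {i} → ∃ (λ j → power j ≡ i) → ι.from i ∈⟨ z ⟩
      from-power (j , ≡.refl) = toℕ j , ι.strictlyInverseʳ _

  order∣|G| : ∀ {y d} → IsOrderOf y d → d ∣ N
  order∣|G| order =
    let M , _ , N≡M*# = lagrange (⟨⟩-isSubgroup order) (∈⟨⟩? order)
    in divides M (≡.trans N≡M*# (≡.cong (M *_) (#⟨⟩≡order order)))

  conj-isDecEquivalence : IsDecEquivalence _∼ᶜ_
  conj-isDecEquivalence = record
    { isEquivalence = ∼ᶜ-isEquivalence
    ; _≟_           = λ x y → ∃? conj-resp (λ g → conj g x ≈? y)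
    }

  open IsDecEquivalence conj-isDecEquivalence using () renaming (_≟_ to _∼ᶜ?_)

  #class : Carrier → ℕ
  #class x = # (x ∼ᶜ?_)

  #centraliser : Carrier → ℕ
  #centraliser x = # (λ g → conj g x ≈? x)

  -- The fibre of g ↦ g x g⁻¹ over a conjugate a x a⁻¹ is the coset a C(x) of the centraliser C(x).
  orbit-stabiliser : ∀ x → N ≡ #centraliser x * #class x
  orbit-stabiliser x = begin
    N                                                        ≡⟨ count-fibres conj-x ⟨
    ∑[ y < N ] count (λ i → conj-x i ≟ y)                    ≡⟨ sum-cong-≗ fibre ⟩
    ∑[ y < N ] (#centraliser x * indicator (x ∼ᶜ? ι.from y)) ≡⟨ *-distribˡ-sum {N} (#centraliser x) _ ⟨
    #centraliser x * #class x                                ∎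
    where
    open ≡.≡-Reasoning
    conj-x : Fin N → Fin N
    conj-x i = ι.to (conj (ι.from i) x)
    conj-x≡⇒≈ : ∀ {i y} → conj-x i ≡ y → conj (ι.from i) x ≈ ι.from y
    conj-x≡⇒≈ ≡.refl = sym (ι.strictlyInverseʳ _)
    ≈⇒conj-x≡ : ∀ {i y} → conj (ι.from i) x ≈ ι.from y → conj-x i ≡ y
    ≈⇒conj-x≡ {y = y} e = ≡.trans (ι.to-cong e) (ι.strictlyInverseˡ y)
    fibre : ∀ y → count (λ i → conj-x i ≟ y) ≡ #centraliser x * indicator (x ∼ᶜ? ι.from y)
    fibre y with x ∼ᶜ? ι.from y
    ... | no x≁y  = ≡.trans (count-none (λ i → conj-x i ≟ y) (λ i eq → x≁y (ι.from i , conj-x≡⇒≈ eq)))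
                            (≡.sym (*-zeroʳ (#centraliser x)))
    ... | yes (a , ax≈y) = begin
      count (λ i → conj-x i ≟ y)       ≡⟨ count-cong _ (λ i → conj (a \\ ι.from i) x ≈? x)
                                                     to-stab from-stab ⟩
      # (λ g → conj (a ⁻¹ ∙ g) x ≈? x) ≡⟨ #-translate conj-resp (λ g → conj g x ≈? x) (a ⁻¹) ⟩
      #centraliser x                   ≡⟨ *-identityʳ _ ⟨
      #centraliser x * 1               ∎
      where
      to-stab : ∀ {i} → conj-x i ≡ y → conj (a \\ ι.from i) x ≈ x
      to-stab eq = same-conj⇒stabilises (trans (conj-x≡⇒≈ eq) (sym ax≈y))
      from-stab : ∀ {i} → conj (a \\ ι.from i) x ≈ x → conj-x i ≡ y
      from-stab fixed = ≈⇒conj-x≡ (trans (stabilises⇒same-conj fixed) ax≈y)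

  #class-central : ∀ {x} → Central x → #class x ≡ 1
  #class-central {x} cx =
    ≡.trans (count-cong (λ i → x ∼ᶜ? ι.from i) (ι.to x ≟_) to-x from-x) (count-singleton (ι.to x))
    where
    to-x : ∀ {i} → x ∼ᶜ ι.from i → ι.to x ≡ i
    to-x {i} (g , gx≈y) =
      ≡.trans (ι.to-cong (trans (sym (central⇒conj-fixed cx g)) gx≈y)) (ι.strictlyInverseˡ i)
    from-x : ∀ {i} → ι.to x ≡ i → x ∼ᶜ ι.from i
    from-x ≡.refl = ≈⇒∼ᶜ (sym (ι.strictlyInverseʳ x))

  #class≡1⇒central : ∀ {x} → #class x ≡ 1 → Central x
  #class≡1⇒central {x} #class≡1 g =
    conj-fixed⇒commute (conj-resp (ι.strictlyInverseʳ g)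
                                  (count≡n⇒∀ (λ i → conj (ι.from i) x ≈? x) #C≡N (ι.to g)))
    where
    #C≡N : #centraliser x ≡ N
    #C≡N = ≡.sym (begin
      N                         ≡⟨ orbit-stabiliser x ⟩
      #centraliser x * #class x ≡⟨ ≡.cong (#centraliser x *_) #class≡1 ⟩
      #centraliser x * 1        ≡⟨ *-identityʳ _ ⟩
      #centraliser x            ∎)
      where open ≡.≡-Reasoning

  conjugacy-classes : Finite (coarsen setoid ∼ᶜ-isEquivalence)
  conjugacy-classes = quotient-finite setoid conj-isDecEquivalence ≈⇒∼ᶜ (N , ι)

  central? : Decidable Central
  central? x = ∀? (λ g≈h gx≈xg → trans (∙-congʳ (sym g≈h)) (trans gx≈xg (∙-congˡ g≈h)))
                  (λ g → g ∙ x ≈? x ∙ g)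

  module _ {p} (p-prime : Prime p) (k : ℕ) (|G|≡p^[1+k] : N ≡ p ^ suc k) where

    -- Class equation: p divides |G| and the size of every conjugacy class of a non-central
    -- element, hence also the size 1 of the class of ε.
    trivial-centre⇒p∣1 : (∀ {y} → Central y → y ≈ ε) → p ∣ 1
    trivial-centre⇒p∣1 trivial with M , φ ← conjugacy-classes =
      ≡.subst (p ∣_) (#class-central (central-resp-≈ (sym rep₀≈ε) central-ε)) p∣size₀
      where
      module φ = Inverse φ
      size : Fin M → ℕ
      size c = #class (φ.from c)
      rep₀≈ε : φ.from (φ.to ε) ≈ ε
      rep₀≈ε with g , gε≈r ← IsEquivalence.sym ∼ᶜ-isEquivalence (φ.strictlyInverseʳ ε) =
        trans (sym gε≈r) (central⇒conj-fixed central-ε g)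
      p∣others : ∀ c → c ≢ φ.to ε → p ∣ size c
      p∣others c c≢c₀ = ∣p^k⇒p∣ p-prime (suc k)
        (divides (#centraliser (φ.from c)) (≡.trans (≡.sym |G|≡p^[1+k]) (orbit-stabiliser _)))
        (λ size≡1 → c≢c₀ (≡.trans (≡.sym (φ.strictlyInverseˡ c))
                                  (φ.to-cong (≈⇒∼ᶜ (trivial (#class≡1⇒central size≡1))))))
      p∣size₀ : p ∣ size (φ.to ε)
      p∣size₀ = ∣-summand size (φ.to ε)
        (≡.subst (p ∣_) (≡.trans (≡.sym |G|≡p^[1+k]) (∑-class-sizes conj-isDecEquivalence ≈⇒∼ᶜ φ))
                        (m∣m*n _))
        p∣others

    nontrivial-centre : ∃ λ y → Central y × y ≉ ε
    nontrivial-centre with ∃? (λ x≈y (cx , x≉ε) → central-resp-≈ x≈y cx , x≉ε ∘ trans x≈y)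
                              (λ y → central? y ×-dec ¬? (y ≈? ε))
    ... | yes witness = witness
    ... | no  ∄y      = contradiction (∣1⇒≡1 (trivial-centre⇒p∣1 λ {y} cy →
                                        decidable-stable (y ≈? ε) λ y≉ε → ∄y (y , cy , y≉ε)))
                                      (λ { ≡.refl → ¬prime[1] p-prime })

    -- The order d of a nontrivial central y divides p ^ (1 + k), so p ∣ d and y ^ (d / p) has
    -- order p.
    central-element-of-order-p : ∃ λ z → Central z × IsOrderOf z p
    central-element-of-order-p =
      let y , cy , y≉ε    = nontrivial-centre
          d , order       = order-exists y
          divides e d≡e*p = ∣p^k⇒p∣ p-prime (suc k) (≡.subst (d ∣_) |G|≡p^[1+k] (order∣|G| order))
                                    (order≢1 order y≉ε)
      in y ^ᵍ e , central-^ᵍ cy e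
       , order-of-power p e (≡.subst (IsOrderOf y) (≡.trans d≡e*p (*-comm e p)) order)

    |G/⟨z⟩| : ∀ {z} (order : IsOrderOf z p) (cz : Central z) → HasOrder (G/⟨z⟩ order cz) (p ^ k)
    |G/⟨z⟩| order cz =
      let M , φ , N≡M*p = lagrange (⟨⟩-isSubgroup order) (∈⟨⟩? order)
          M≡p^k : M ≡ p ^ k
          M≡p^k = *-cancelʳ-≡ M (p ^ k) p {{prime⇒nonZero p-prime}} (begin
            M * p              ≡⟨ ≡.cong (M *_) (#⟨⟩≡order order) ⟨
            M * # (∈⟨⟩? order) ≡⟨ N≡M*p ⟨
            N                  ≡⟨ |G|≡p^[1+k] ⟩
            p * p ^ k          ≡⟨ *-comm p (p ^ k) ⟩
            p ^ k * p          ∎)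
      in ≡.subst (λ m → Inverse (Group.setoid (G/⟨z⟩ order cz)) (≡-setoid (Fin m))) M≡p^k φ
      where open ≡.≡-Reasoning

-- The subgroup G^#

RepresentativesModSharp : ∀ {c ℓ} (G : Group c ℓ) → ℕ → Set (lsuc (c ⊔ ℓ))
RepresentativesModSharp G q =
  ∀ g → ∃ λ h → InSharp G q (Group._∙_ G (Group._⁻¹ G g) h) × OrderDivides G h q

sharp⇒trivial : ∀ {c ℓ} (G : Group c ℓ) q {x} → IsFiniteGroup G → ExponentDivides G q →
                InSharp G q x → Group._≈_ G x (Group.ε G)
sharp⇒trivial G q finite exponent x∈G# =
  x∈G# G finite exponent id (isGroupHomomorphism (Group.rawGroup G) (Group.refl G))

module _ {c ℓ} (G : Group c ℓ) where
  open Group G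
  open GroupTheory G

  module _ {H : Pred Carrier ℓ} (H-sub : IsSubgroup H) (H-normal : IsNormal H) where
    open Cosets H-sub

    sharp-in-quotient : ∀ q {x} → InSharp G q x → InSharp (quotientGroup H-sub H-normal) q x
    sharp-in-quotient q x∈G# K finite exponent f hom =
      x∈G# K finite exponent f (hom-from-quotient H-sub H-normal K hom)

    representatives-in-quotient : ∀ q → RepresentativesModSharp G q →
                                  RepresentativesModSharp (quotientGroup H-sub H-normal) q
    representatives-in-quotient q reps g with h , g⁻¹h∈G# , hᵠ≈ε ← reps g =
      h , sharp-in-quotient q g⁻¹h∈G#
        , ≡.subst (_∼ ε) (≡.sym (^ᵍ-quotient H-sub H-normal h q)) (≈⇒∼ hᵠ≈ε)

  exponent-from-quotient : ∀ {q z d} (order : IsOrderOf z d) (cz : Central z) → d ∣ q →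
                           IsFiniteGroup (G/⟨z⟩ order cz) → ExponentDivides (G/⟨z⟩ order cz) q →
                           RepresentativesModSharp G q → ExponentDivides G q
  exponent-from-quotient {q} {z} order cz d∣q finite exponent reps g
    with h , g⁻¹h∈G# , hᵠ≈ε ← reps g = begin
    g ^ᵍ q                  ≈⟨ ^ᵍ-congˡ q (\\-leftDividesˡ h g) ⟨
    (h ∙ (h \\ g)) ^ᵍ q     ≈⟨ ^ᵍ-distrib-central h (∈⟨central⟩⇒central cz h⁻¹g∈⟨z⟩) q ⟩
    h ^ᵍ q ∙ (h \\ g) ^ᵍ q  ≈⟨ ∙-cong hᵠ≈ε (∈⟨⟩-exponent (IsOrderOf.^order≈ε order) d∣q h⁻¹g∈⟨z⟩) ⟩
    ε ∙ ε                   ≈⟨ identityˡ ε ⟩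
    ε                       ∎
    where
    open import Relation.Binary.Reasoning.Setoid setoid
    ⟨z⟩ : IsSubgroup (_∈⟨ z ⟩)
    ⟨z⟩ = ⟨⟩-isSubgroup order
    open Cosets ⟨z⟩ using (_∼_)
    g⁻¹h∼ε : g ⁻¹ ∙ h ∼ ε
    g⁻¹h∼ε = sharp⇒trivial (G/⟨z⟩ order cz) q finite exponent
               (sharp-in-quotient ⟨z⟩ (⟨⟩-isNormal order cz) q g⁻¹h∈G#)
    h⁻¹g∈⟨z⟩ : h \\ g ∈⟨ z ⟩
    h⁻¹g∈⟨z⟩ = IsSubgroup.resp-≈ ⟨z⟩ (begin
      (g ⁻¹ ∙ h) ⁻¹ ∙ ε    ≈⟨ identityʳ _ ⟩
      (g ⁻¹ ∙ h) ⁻¹        ≈⟨ ⁻¹-anti-homo-∙ (g ⁻¹) h ⟩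
      h ⁻¹ ∙ g ⁻¹ ⁻¹       ≈⟨ ∙-congˡ (⁻¹-involutive g) ⟩
      h \\ g               ∎) g⁻¹h∼ε

module _ {p q} (p-prime : Prime p) (p∣q : p ∣ q) where

  exponent-divides : ∀ {c ℓ} k (G : Group c ℓ) → HasOrder G (p ^ k) → RepresentativesModSharp G q →
                     ExponentDivides G q
  exponent-divides zero G ι _ x = trans (^ᵍ-congˡ q (ι-injective (Fin1-unique _ _))) (ε^ᵍ q)
    where
    open Group G
    open GroupTheory G
    open FiniteSetoid setoid ι
    Fin1-unique : ∀ (i j : Fin 1) → i ≡ j
    Fin1-unique zero zero = ≡.refl
  exponent-divides (suc k) G ι reps =
    by-central-element (FiniteGroup.central-element-of-order-p G ι p-prime k ≡.refl)
    where
    open GroupTheory G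
    by-central-element : ∃ (λ z → Central z × IsOrderOf z p) → ExponentDivides G q
    by-central-element (z , cz , order) = exponent-from-quotient G order cz p∣q (p ^ k , |G/⟨z⟩|)
      (exponent-divides k (G/⟨z⟩ order cz) |G/⟨z⟩|
        (representatives-in-quotient G (⟨⟩-isSubgroup order) (⟨⟩-isNormal order cz) q reps))
      reps
      where
      |G/⟨z⟩| : HasOrder (G/⟨z⟩ order cz) (p ^ k)
      |G/⟨z⟩| = FiniteGroup.|G/⟨z⟩| G ι p-prime k ≡.refl order cz

lemma7 : ∀ {c ℓ} (n p m : ℕ) → 2 ≤ n → Prime p →
         n ≤ p ^ m → (∀ k → n ≤ p ^ k → m ≤ k) →
         (G : Group c ℓ) → IsFinitePGroup p G →
         (∀ g → ∃ λ h → InSharp G (p ^ m) (Group._∙_ G (Group._⁻¹ G g) h) × OrderDivides G h (p ^ m)) →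
         ∀ x → InSharp G (p ^ m) x → Group._≈_ G x (Group.ε G)
lemma7 n p zero    2≤n _       n≤1 _ G _       _    _ _   = ⊥-elim (<⇒≱ 2≤n n≤1)
lemma7 n p (suc m) _   p-prime _   _ G (k , ι) reps x x∈G# =
  sharp⇒trivial G (p ^ suc m) (p ^ k , ι) (exponent-divides p-prime (m∣m*n (p ^ m)) k G ι reps) x∈G#
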